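{- Let $F:\mathcal{A}\to\mathcal{C}$ and $G:\mathcal{B}\to\mathcal{C}$ be functors, $\mathcal{G}=(F\downarrow G)$. Assume $\mathcal{A}$ is regular and $F$ is faithful and has a right adjoint $F^{\star}$ with counit $\theta:FF^{\star}\to\mathrm{id}_{\mathcal{C}}$. For $(A,f,B)$ in $\mathcal{G}$ let $\hat f:A\to F^{\star}G(B)$ be the unique morphism with $\theta_{G(B)}\circ F(\hat f)=f$, let $\hat f=m_{\hat f}\circ e_{\hat f}$ be an image factorization ($e_{\hat f}:A\to\mathrm{Ran}(\hat f)$ a regular epimorphism, $m_{\hat f}:\mathrm{Ran}(\hat f)\to F^{\star}G(B)$ a monomorphism), define $\mathcal{S}(A,f,B)=(\mathrm{Ran}(\hat f),\theta_{G(B)}\circ F(m_{\hat f}),B)$ and $\eta_{(A,f,B)}=(e_{\hat f},\mathrm{id}_B):(A,f,B)\to\mathcal{S}(A,f,B)$. If $(\phi,\psi):(A,f,B)\to(A',f',B')$ is a morphism in $\mathcal{G}$ and $(A',f',B')$ is simple, then there is a unique morphism $(\hat\phi,\hat\psi):\mathcal{S}(A,f,B)\to(A',f',B')$ in $\mathcal{G}$ such that $(\hat\phi,\hat\psi)\circ\eta_{(A,f,B)}=(\phi,\psi)$.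
   Context: The comma category $(F\downarrow G)$ has objects $(A,f,B)$ with $A\in\mathcal{A}$, $B\in\mathcal{B}$, $f:F(A)\to G(B)$ in $\mathcal{C}$, and morphisms $(\phi,\psi):(A,f,B)\to(A',f',B')$ with $f'\circ F(\phi)=G(\psi)\circ f$; composition is componentwise. An object $(A,f,B)$ is simple if $f$ is a monomorphism in $\mathcal{C}$. -}

module Defs where

open import Level using (Level; _⊔_; suc)
open import Data.Product using (Σ; Σ-syntax; _×_; _,_; proj₁; proj₂)
open import Relation.Binary.PropositionalEquality
  using (_≡_; refl; sym; trans; cong; cong₂; module ≡-Reasoning)

record Category (o ℓ : Level) : Set (suc (o ⊔ ℓ)) where
  infixr 9 _∘_
  infix  4 _⇒_
  field
    Obj  : Set o
    _⇒_  : Obj → Obj → Set ℓ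
    id   : ∀ {A} → A ⇒ A
    _∘_  : ∀ {A B C} → B ⇒ C → A ⇒ B → A ⇒ C
    assoc     : ∀ {A B C D} {f : A ⇒ B} {g : B ⇒ C} {h : C ⇒ D} →
                (h ∘ g) ∘ f ≡ h ∘ (g ∘ f)
    identityˡ : ∀ {A B} {f : A ⇒ B} → id ∘ f ≡ f
    identityʳ : ∀ {A B} {f : A ⇒ B} → f ∘ id ≡ f

  Mono : ∀ {A B} → A ⇒ B → Set (o ⊔ ℓ)
  Mono {A} f = ∀ {X} (g h : X ⇒ A) → f ∘ g ≡ f ∘ h → g ≡ h

  IsCoequalizer : ∀ {X A Q} → X ⇒ A → X ⇒ A → A ⇒ Q → Set (o ⊔ ℓ)
  IsCoequalizer {X} {A} {Q} g h e =
    (e ∘ g ≡ e ∘ h) ×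
    (∀ {Z} (k : A ⇒ Z) → k ∘ g ≡ k ∘ h →
       Σ (Q ⇒ Z) λ u → (u ∘ e ≡ k) × (∀ (u' : Q ⇒ Z) → u' ∘ e ≡ k → u' ≡ u))

  RegularEpi : ∀ {A Q} → A ⇒ Q → Set (o ⊔ ℓ)
  RegularEpi {A} e = Σ Obj λ X → Σ (X ⇒ A) λ g → Σ (X ⇒ A) λ h → IsCoequalizer g h e

  IsTerminal : Obj → Set (o ⊔ ℓ)
  IsTerminal T = ∀ X → Σ (X ⇒ T) λ t → ∀ (t' : X ⇒ T) → t' ≡ t

  IsPullback : ∀ {P A B C} (f : A ⇒ C) (g : B ⇒ C) (p₁ : P ⇒ A) (p₂ : P ⇒ B) →
               Set (o ⊔ ℓ)
  IsPullback {P} {A} {B} f g p₁ p₂ =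
    (f ∘ p₁ ≡ g ∘ p₂) ×
    (∀ {Z} (q₁ : Z ⇒ A) (q₂ : Z ⇒ B) → f ∘ q₁ ≡ g ∘ q₂ →
       Σ (Z ⇒ P) λ u → (p₁ ∘ u ≡ q₁) × (p₂ ∘ u ≡ q₂) ×
         (∀ (u' : Z ⇒ P) → p₁ ∘ u' ≡ q₁ → p₂ ∘ u' ≡ q₂ → u' ≡ u))

  record Pullback {A B C} (f : A ⇒ C) (g : B ⇒ C) : Set (o ⊔ ℓ) where
    field
      P   : Obj
      p₁  : P ⇒ A
      p₂  : P ⇒ B
      isPullback : IsPullback f g p₁ p₂

  record IsRegular : Set (o ⊔ ℓ) where
    field
      terminal     : Σ Obj IsTerminal
      pullback     : ∀ {A B C} (f : A ⇒ C) (g : B ⇒ C) → Pullback f g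
      coeqKernelPair : ∀ {A B} (f : A ⇒ B) (K : Pullback f f) →
        Σ Obj λ Q → Σ (A ⇒ Q) λ q →
          IsCoequalizer (Pullback.p₁ K) (Pullback.p₂ K) q
      regularEpi-stable : ∀ {P A B C} (e : A ⇒ C) (g : B ⇒ C)
        (p₁ : P ⇒ A) (p₂ : P ⇒ B) →
        IsPullback e g p₁ p₂ → RegularEpi e → RegularEpi p₂

record Functor {o₁ ℓ₁ o₂ ℓ₂} (C : Category o₁ ℓ₁) (D : Category o₂ ℓ₂)
       : Set (o₁ ⊔ ℓ₁ ⊔ o₂ ⊔ ℓ₂) where
  private
    module C = Category C
    module D = Category D
  field
    F₀ : C.Obj → D.Obj
    F₁ : ∀ {A B} → A C.⇒ B → F₀ A D.⇒ F₀ B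
    identity     : ∀ {A} → F₁ (C.id {A}) ≡ D.id
    homomorphism : ∀ {A B E} {f : A C.⇒ B} {g : B C.⇒ E} →
                   F₁ (g C.∘ f) ≡ F₁ g D.∘ F₁ f

Faithful : ∀ {o₁ ℓ₁ o₂ ℓ₂} {C : Category o₁ ℓ₁} {D : Category o₂ ℓ₂} →
           Functor C D → Set (o₁ ⊔ ℓ₁ ⊔ ℓ₂)
Faithful {C = C} F = ∀ {A B} (f g : A C.⇒ B) → F₁ f ≡ F₁ g → f ≡ g
  where module C = Category C
        open Functor F

record Adjunction {o₁ ℓ₁ o₂ ℓ₂} {C : Category o₁ ℓ₁} {D : Category o₂ ℓ₂}
       (L : Functor C D) (R : Functor D C) : Set (o₁ ⊔ ℓ₁ ⊔ o₂ ⊔ ℓ₂) where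
  private
    module C = Category C
    module D = Category D
    module L = Functor L
    module R = Functor R
  field
    unit   : ∀ A → A C.⇒ R.F₀ (L.F₀ A)
    counit : ∀ X → L.F₀ (R.F₀ X) D.⇒ X
    unit-natural   : ∀ {A B} (f : A C.⇒ B) →
                     unit B C.∘ f ≡ R.F₁ (L.F₁ f) C.∘ unit A
    counit-natural : ∀ {X Y} (g : X D.⇒ Y) →
                     counit Y D.∘ L.F₁ (R.F₁ g) ≡ g D.∘ counit X
    zig : ∀ A → counit (L.F₀ A) D.∘ L.F₁ (unit A) ≡ D.id
    zag : ∀ X → R.F₁ (counit X) C.∘ unit (R.F₀ X) ≡ C.id

module Comma {oa ℓa ob ℓb oc ℓc}
  {𝒜 : Category oa ℓa} {ℬ : Category ob ℓb} {𝒞 : Category oc ℓc}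
  (F : Functor 𝒜 𝒞) (G : Functor ℬ 𝒞) where

  private
    module 𝒜 = Category 𝒜
    module ℬ = Category ℬ
    module 𝒞 = Category 𝒞
    module F = Functor F
    module G = Functor G

  record CommaObj : Set (oa ⊔ ob ⊔ ℓc) where
    constructor mkObj
    field
      A : 𝒜.Obj
      B : ℬ.Obj
      f : F.F₀ A 𝒞.⇒ G.F₀ B

  Simple : CommaObj → Set (oc ⊔ ℓc)
  Simple X = 𝒞.Mono (CommaObj.f X)

  record CommaHom (X Y : CommaObj) : Set (ℓa ⊔ ℓb ⊔ ℓc) where
    constructor mkHom
    private
      module X = CommaObj X
      module Y = CommaObj Y
    field
      φ : X.A 𝒜.⇒ Y.A
      ψ : X.B ℬ.⇒ Y.B
      commute : Y.f 𝒞.∘ F.F₁ φ ≡ G.F₁ ψ 𝒞.∘ X.f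

  _≈_ : ∀ {X Y} → CommaHom X Y → CommaHom X Y → Set (ℓa ⊔ ℓb)
  h ≈ k = (CommaHom.φ h ≡ CommaHom.φ k) × (CommaHom.ψ h ≡ CommaHom.ψ k)

  _∘_ : ∀ {X Y Z} → CommaHom Y Z → CommaHom X Y → CommaHom X Z
  _∘_ {X} {Y} {Z} (mkHom φ₂ ψ₂ c₂) (mkHom φ₁ ψ₁ c₁) =
    mkHom (φ₂ 𝒜.∘ φ₁) (ψ₂ ℬ.∘ ψ₁) proof
    where
      open ≡-Reasoning
      module X = CommaObj X
      module Y = CommaObj Y
      module Z = CommaObj Z
      proof : Z.f 𝒞.∘ F.F₁ (φ₂ 𝒜.∘ φ₁) ≡ G.F₁ (ψ₂ ℬ.∘ ψ₁) 𝒞.∘ X.f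
      proof = begin
        Z.f 𝒞.∘ F.F₁ (φ₂ 𝒜.∘ φ₁)          ≡⟨ cong (Z.f 𝒞.∘_) F.homomorphism ⟩
        Z.f 𝒞.∘ (F.F₁ φ₂ 𝒞.∘ F.F₁ φ₁)     ≡⟨ sym 𝒞.assoc ⟩
        (Z.f 𝒞.∘ F.F₁ φ₂) 𝒞.∘ F.F₁ φ₁     ≡⟨ cong (𝒞._∘ F.F₁ φ₁) c₂ ⟩
        (G.F₁ ψ₂ 𝒞.∘ Y.f) 𝒞.∘ F.F₁ φ₁     ≡⟨ 𝒞.assoc ⟩
        G.F₁ ψ₂ 𝒞.∘ (Y.f 𝒞.∘ F.F₁ φ₁)     ≡⟨ cong (G.F₁ ψ₂ 𝒞.∘_) c₁ ⟩
        G.F₁ ψ₂ 𝒞.∘ (G.F₁ ψ₁ 𝒞.∘ X.f)     ≡⟨ sym 𝒞.assoc ⟩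
        (G.F₁ ψ₂ 𝒞.∘ G.F₁ ψ₁) 𝒞.∘ X.f     ≡⟨ cong (𝒞._∘ X.f) (sym G.homomorphism) ⟩
        G.F₁ (ψ₂ ℬ.∘ ψ₁) 𝒞.∘ X.f          ∎

  module _ {Fs : Functor 𝒞 𝒜} (adj : Adjunction F Fs) where
    private
      module Fs = Functor Fs
    θ : ∀ X → F.F₀ (Fs.F₀ X) 𝒞.⇒ X
    θ = Adjunction.counit adj

    record ImageData (X : CommaObj) : Set (oa ⊔ ℓa ⊔ ℓc) where
      private module X = CommaObj X
      field
        fhat    : X.A 𝒜.⇒ Fs.F₀ (G.F₀ X.B)
        fhat-eq : θ (G.F₀ X.B) 𝒞.∘ F.F₁ fhat ≡ X.f
        Ran     : 𝒜.Obj
        e       : X.A 𝒜.⇒ Ran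
        m       : Ran 𝒜.⇒ Fs.F₀ (G.F₀ X.B)
        factor  : m 𝒜.∘ e ≡ fhat
        e-regular : 𝒜.RegularEpi e
        m-mono    : 𝒜.Mono m

    S : (X : CommaObj) → ImageData X → CommaObj
    S X I = mkObj (ImageData.Ran I)
                  (CommaObj.B X)
                  (θ (G.F₀ (CommaObj.B X)) 𝒞.∘ F.F₁ (ImageData.m I))

    η : (X : CommaObj) (I : ImageData X) → CommaHom X (S X I)
    η X I = mkHom e ℬ.id proof
      where
        open ImageData I
        open ≡-Reasoning
        module X = CommaObj X
        proof : (θ (G.F₀ X.B) 𝒞.∘ F.F₁ m) 𝒞.∘ F.F₁ e ≡ G.F₁ ℬ.id 𝒞.∘ X.f
        proof = begin
          (θ (G.F₀ X.B) 𝒞.∘ F.F₁ m) 𝒞.∘ F.F₁ e ≡⟨ 𝒞.assoc ⟩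
          θ (G.F₀ X.B) 𝒞.∘ (F.F₁ m 𝒞.∘ F.F₁ e) ≡⟨ cong (θ (G.F₀ X.B) 𝒞.∘_) (sym F.homomorphism) ⟩
          θ (G.F₀ X.B) 𝒞.∘ F.F₁ (m 𝒜.∘ e)      ≡⟨ cong (λ z → θ (G.F₀ X.B) 𝒞.∘ F.F₁ z) factor ⟩
          θ (G.F₀ X.B) 𝒞.∘ F.F₁ fhat           ≡⟨ fhat-eq ⟩
          X.f                                  ≡⟨ sym 𝒞.identityˡ ⟩
          𝒞.id 𝒞.∘ X.f                         ≡⟨ cong (𝒞._∘ X.f) (sym G.identity) ⟩
          G.F₁ ℬ.id 𝒞.∘ X.f                    ∎

-- Since e is the coequalizer of some pair g₁, g₂, it suffices that φ ∘ g₁ = φ ∘ g₂. As f factors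
-- through F(e), f ∘ F(g₁) = f ∘ F(g₂); the square of (φ, ψ) then gives f' ∘ F(φ ∘ g₁) = f' ∘ F(φ ∘ g₂),
-- and f' mono with F faithful yields the claim. The induced map commutes because F, a left adjoint,
-- sends the epi e to an epi, and uniqueness is again e epi.
module Submission where

open import Defs
open import Level using (Level; _⊔_)
open import Data.Product using (Σ; _×_; _,_; proj₁; proj₂)
open import Relation.Binary.PropositionalEquality
  using (_≡_; refl; sym; trans; cong; subst; module ≡-Reasoning)

module _ {o ℓ} (𝒞 : Category o ℓ) where
  open Category 𝒞

  Epi : ∀ {A Q} → A ⇒ Q → Set (o ⊔ ℓ)
  Epi {Q = Q} e = ∀ {Z} (a b : Q ⇒ Z) → a ∘ e ≡ b ∘ e → a ≡ b

  id-Mono : ∀ {A} → Mono (id {A})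
  id-Mono g h id∘g≡id∘h = trans (sym identityˡ) (trans id∘g≡id∘h identityˡ)

  RegularEpi⇒Epi : ∀ {A Q} {e : A ⇒ Q} → RegularEpi e → Epi e
  RegularEpi⇒Epi {e = e} (_ , g₁ , g₂ , e∘g₁≡e∘g₂ , universal) a b a∘e≡b∘e =
    let (_ , _ , unique) = universal (a ∘ e) a∘e-coequalizes
    in trans (unique a refl) (sym (unique b (sym a∘e≡b∘e)))
    where
      a∘e-coequalizes : (a ∘ e) ∘ g₁ ≡ (a ∘ e) ∘ g₂
      a∘e-coequalizes = trans assoc (trans (cong (a ∘_) e∘g₁≡e∘g₂) (sym assoc))

  factor-through-RegularEpi : ∀ {A Q Z} {e : A ⇒ Q} → RegularEpi e → (φ : A ⇒ Z) →
    (∀ {W} (g₁ g₂ : W ⇒ A) → e ∘ g₁ ≡ e ∘ g₂ → φ ∘ g₁ ≡ φ ∘ g₂) →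
    Σ (Q ⇒ Z) λ u → u ∘ e ≡ φ
  factor-through-RegularEpi (_ , g₁ , g₂ , e∘g₁≡e∘g₂ , universal) φ respects =
    let (u , u∘e≡φ , _) = universal φ (respects g₁ g₂ e∘g₁≡e∘g₂) in u , u∘e≡φ

module _ {o₁ ℓ₁ o₂ ℓ₂} {𝒞 : Category o₁ ℓ₁} {𝒟 : Category o₂ ℓ₂}
  {L : Functor 𝒞 𝒟} {R : Functor 𝒟 𝒞} (adj : Adjunction L R) where
  private
    module C = Category 𝒞
    module D = Category 𝒟
    module L = Functor L
    module R = Functor R
  open Adjunction adj
  open ≡-Reasoning

  rightAdjunct : ∀ {Y Z} → L.F₀ Y D.⇒ Z → Y C.⇒ R.F₀ Z
  rightAdjunct {Y} a = R.F₁ a C.∘ unit Y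

  counit-rightAdjunct : ∀ {Y Z} (a : L.F₀ Y D.⇒ Z) →
    counit Z D.∘ L.F₁ (rightAdjunct a) ≡ a
  counit-rightAdjunct {Y} {Z} a = begin
    counit Z D.∘ L.F₁ (R.F₁ a C.∘ unit Y)             ≡⟨ cong (counit Z D.∘_) L.homomorphism ⟩
    counit Z D.∘ (L.F₁ (R.F₁ a) D.∘ L.F₁ (unit Y))    ≡⟨ sym D.assoc ⟩
    (counit Z D.∘ L.F₁ (R.F₁ a)) D.∘ L.F₁ (unit Y)    ≡⟨ cong (D._∘ L.F₁ (unit Y)) (counit-natural a) ⟩
    (a D.∘ counit (L.F₀ Y)) D.∘ L.F₁ (unit Y)         ≡⟨ D.assoc ⟩
    a D.∘ (counit (L.F₀ Y) D.∘ L.F₁ (unit Y))         ≡⟨ cong (a D.∘_) (zig Y) ⟩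
    a D.∘ D.id                                        ≡⟨ D.identityʳ ⟩
    a                                                 ∎

  rightAdjunct-natural : ∀ {X Y Z} (a : L.F₀ Y D.⇒ Z) (e : X C.⇒ Y) →
    rightAdjunct a C.∘ e ≡ rightAdjunct (a D.∘ L.F₁ e)
  rightAdjunct-natural {X} {Y} a e = begin
    (R.F₁ a C.∘ unit Y) C.∘ e                  ≡⟨ C.assoc ⟩
    R.F₁ a C.∘ (unit Y C.∘ e)                  ≡⟨ cong (R.F₁ a C.∘_) (unit-natural e) ⟩
    R.F₁ a C.∘ (R.F₁ (L.F₁ e) C.∘ unit X)      ≡⟨ sym C.assoc ⟩
    (R.F₁ a C.∘ R.F₁ (L.F₁ e)) C.∘ unit X      ≡⟨ cong (C._∘ unit X) (sym R.homomorphism) ⟩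
    R.F₁ (a D.∘ L.F₁ e) C.∘ unit X             ∎

  left-adjoint-preserves-Epi : ∀ {X Y} {e : X C.⇒ Y} → Epi 𝒞 e → Epi 𝒟 (L.F₁ e)
  left-adjoint-preserves-Epi {e = e} e-epi a b a∘Le≡b∘Le = begin
    a                                            ≡⟨ sym (counit-rightAdjunct a) ⟩
    counit _ D.∘ L.F₁ (rightAdjunct a)           ≡⟨ cong (λ t → counit _ D.∘ L.F₁ t) adjuncts-equal ⟩
    counit _ D.∘ L.F₁ (rightAdjunct b)           ≡⟨ counit-rightAdjunct b ⟩
    b                                            ∎
    where
      adjuncts-equal : rightAdjunct a ≡ rightAdjunct b
      adjuncts-equal = e-epi (rightAdjunct a) (rightAdjunct b) (begin
        rightAdjunct a C.∘ e              ≡⟨ rightAdjunct-natural a e ⟩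
        rightAdjunct (a D.∘ L.F₁ e)       ≡⟨ cong rightAdjunct a∘Le≡b∘Le ⟩
        rightAdjunct (b D.∘ L.F₁ e)       ≡⟨ sym (rightAdjunct-natural b e) ⟩
        rightAdjunct b C.∘ e              ∎)

module _ {oa ℓa ob ℓb oc ℓc}
  {𝒜 : Category oa ℓa} {ℬ : Category ob ℓb} {𝒞 : Category oc ℓc}
  (F : Functor 𝒜 𝒞) (G : Functor ℬ 𝒞) where
  private
    module 𝒜 = Category 𝒜
    module ℬ = Category ℬ
    module 𝒞 = Category 𝒞
    module F = Functor F
    module G = Functor G
  open Comma F G
  open CommaObj
  open CommaHom
  open ≡-Reasoning

  commute-∘ : ∀ {X Y W} (h : CommaHom X Y) (g : W 𝒜.⇒ A X) →
    f Y 𝒞.∘ F.F₁ (φ h 𝒜.∘ g) ≡ G.F₁ (ψ h) 𝒞.∘ (f X 𝒞.∘ F.F₁ g)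
  commute-∘ {X} {Y} h g = begin
    f Y 𝒞.∘ F.F₁ (φ h 𝒜.∘ g)              ≡⟨ cong (f Y 𝒞.∘_) F.homomorphism ⟩
    f Y 𝒞.∘ (F.F₁ (φ h) 𝒞.∘ F.F₁ g)       ≡⟨ sym 𝒞.assoc ⟩
    (f Y 𝒞.∘ F.F₁ (φ h)) 𝒞.∘ F.F₁ g       ≡⟨ cong (𝒞._∘ F.F₁ g) (commute h) ⟩
    (G.F₁ (ψ h) 𝒞.∘ f X) 𝒞.∘ F.F₁ g       ≡⟨ 𝒞.assoc ⟩
    G.F₁ (ψ h) 𝒞.∘ (f X 𝒞.∘ F.F₁ g)       ∎

  φ-equalizes-kernel-of-f : Faithful F → ∀ {X X'} (h : CommaHom X X') → Simple X' →
    ∀ {W} (g₁ g₂ : W 𝒜.⇒ A X) → f X 𝒞.∘ F.F₁ g₁ ≡ f X 𝒞.∘ F.F₁ g₂ →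
    φ h 𝒜.∘ g₁ ≡ φ h 𝒜.∘ g₂
  φ-equalizes-kernel-of-f faithful {X} {X'} h simple g₁ g₂ f∘Fg₁≡f∘Fg₂ =
    faithful _ _ (simple _ _ (begin
      f X' 𝒞.∘ F.F₁ (φ h 𝒜.∘ g₁)            ≡⟨ commute-∘ h g₁ ⟩
      G.F₁ (ψ h) 𝒞.∘ (f X 𝒞.∘ F.F₁ g₁)      ≡⟨ cong (G.F₁ (ψ h) 𝒞.∘_) f∘Fg₁≡f∘Fg₂ ⟩
      G.F₁ (ψ h) 𝒞.∘ (f X 𝒞.∘ F.F₁ g₂)      ≡⟨ sym (commute-∘ h g₂) ⟩
      f X' 𝒞.∘ F.F₁ (φ h 𝒜.∘ g₂)            ∎))

  kernel-of-φ⊆kernel-of-f : ∀ {X Y} (k : CommaHom X Y) → 𝒞.Mono (G.F₁ (ψ k)) →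
    ∀ {W} (g₁ g₂ : W 𝒜.⇒ A X) → φ k 𝒜.∘ g₁ ≡ φ k 𝒜.∘ g₂ →
    f X 𝒞.∘ F.F₁ g₁ ≡ f X 𝒞.∘ F.F₁ g₂
  kernel-of-φ⊆kernel-of-f {X} {Y} k Gψk-mono g₁ g₂ φk∘g₁≡φk∘g₂ =
    Gψk-mono _ _ (begin
      G.F₁ (ψ k) 𝒞.∘ (f X 𝒞.∘ F.F₁ g₁)      ≡⟨ sym (commute-∘ k g₁) ⟩
      f Y 𝒞.∘ F.F₁ (φ k 𝒜.∘ g₁)             ≡⟨ cong (λ t → f Y 𝒞.∘ F.F₁ t) φk∘g₁≡φk∘g₂ ⟩
      f Y 𝒞.∘ F.F₁ (φ k 𝒜.∘ g₂)             ≡⟨ commute-∘ k g₂ ⟩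
      G.F₁ (ψ k) 𝒞.∘ (f X 𝒞.∘ F.F₁ g₂)      ∎)

  factor-through : ∀ {X Y X'} (k : CommaHom X Y) → Epi 𝒞 (F.F₁ (φ k)) →
    (h : CommaHom X X') (u : A Y 𝒜.⇒ A X') (v : B Y ℬ.⇒ B X') →
    u 𝒜.∘ φ k ≡ φ h → v ℬ.∘ ψ k ≡ ψ h → CommaHom Y X'
  factor-through {X} {Y} {X'} k Fφk-epi h u v u∘φk≡φh v∘ψk≡ψh =
    mkHom u v (Fφk-epi _ _ (begin
      (f X' 𝒞.∘ F.F₁ u) 𝒞.∘ F.F₁ (φ k)     ≡⟨ 𝒞.assoc ⟩
      f X' 𝒞.∘ (F.F₁ u 𝒞.∘ F.F₁ (φ k))     ≡⟨ cong (f X' 𝒞.∘_) (sym F.homomorphism) ⟩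
      f X' 𝒞.∘ F.F₁ (u 𝒜.∘ φ k)            ≡⟨ cong (λ t → f X' 𝒞.∘ F.F₁ t) u∘φk≡φh ⟩
      f X' 𝒞.∘ F.F₁ (φ h)                  ≡⟨ commute h ⟩
      G.F₁ (ψ h) 𝒞.∘ f X                   ≡⟨ cong (λ t → G.F₁ t 𝒞.∘ f X) (sym v∘ψk≡ψh) ⟩
      G.F₁ (v ℬ.∘ ψ k) 𝒞.∘ f X             ≡⟨ cong (𝒞._∘ f X) G.homomorphism ⟩
      (G.F₁ v 𝒞.∘ G.F₁ (ψ k)) 𝒞.∘ f X      ≡⟨ 𝒞.assoc ⟩
      G.F₁ v 𝒞.∘ (G.F₁ (ψ k) 𝒞.∘ f X)      ≡⟨ cong (G.F₁ v 𝒞.∘_) (sym (commute k)) ⟩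
      G.F₁ v 𝒞.∘ (f Y 𝒞.∘ F.F₁ (φ k))      ≡⟨ sym 𝒞.assoc ⟩
      (G.F₁ v 𝒞.∘ f Y) 𝒞.∘ F.F₁ (φ k)      ∎))

mainTheorem5 : ∀ {oa ℓa ob ℓb oc ℓc : Level}
    {𝒜 : Category oa ℓa} {ℬ : Category ob ℓb} {𝒞 : Category oc ℓc}
    (F : Functor 𝒜 𝒞) (G : Functor ℬ 𝒞) →
    Category.IsRegular 𝒜 →
    Faithful F →
    (Fs : Functor 𝒞 𝒜) (adj : Adjunction F Fs) →
    (X : Comma.CommaObj F G) (I : Comma.ImageData F G adj X) →
    (X' : Comma.CommaObj F G) (h : Comma.CommaHom F G X X') →
    Comma.Simple F G X' →
    Σ (Comma.CommaHom F G (Comma.S F G adj X I) X') λ k →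
      Comma._≈_ F G (Comma._∘_ F G k (Comma.η F G adj X I)) h ×
      (∀ (k' : Comma.CommaHom F G (Comma.S F G adj X I) X') →
        Comma._≈_ F G (Comma._∘_ F G k' (Comma.η F G adj X I)) h →
        Comma._≈_ F G k' k)
mainTheorem5 {𝒜 = 𝒜} {ℬ} {𝒞} F G _ faithful Fs adj X I X' h simple =
  k , (u∘e≡φ , ℬ.identityʳ) , unique
  where
  module 𝒜 = Category 𝒜
  module ℬ = Category ℬ
  module 𝒞 = Category 𝒞
  module G = Functor G
  open Comma F G
  open ImageData I
  open CommaHom h using (φ; ψ)

  e-epi : Epi 𝒜 e
  e-epi = RegularEpi⇒Epi 𝒜 e-regular

  Gid-Mono : 𝒞.Mono (G.F₁ (ℬ.id {CommaObj.B X}))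
  Gid-Mono = subst 𝒞.Mono (sym G.identity) (id-Mono 𝒞)

  factorization : Σ (Ran 𝒜.⇒ CommaObj.A X') λ u → u 𝒜.∘ e ≡ φ
  factorization = factor-through-RegularEpi 𝒜 e-regular φ λ g₁ g₂ e∘g₁≡e∘g₂ →
    φ-equalizes-kernel-of-f F G faithful h simple g₁ g₂
      (kernel-of-φ⊆kernel-of-f F G (η adj X I) Gid-Mono g₁ g₂ e∘g₁≡e∘g₂)

  u : Ran 𝒜.⇒ CommaObj.A X'
  u = proj₁ factorization

  u∘e≡φ : u 𝒜.∘ e ≡ φ
  u∘e≡φ = proj₂ factorization

  k : CommaHom (S adj X I) X'
  k = factor-through F G (η adj X I) (left-adjoint-preserves-Epi adj e-epi)
        h u ψ u∘e≡φ ℬ.identityʳ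

  unique : ∀ k' → (k' ∘ η adj X I) ≈ h → k' ≈ k
  unique k' (φ'∘e≡φ , ψ'∘id≡ψ) =
    e-epi _ _ (trans φ'∘e≡φ (sym u∘e≡φ)) , trans (sym ℬ.identityʳ) ψ'∘id≡ψ
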